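{- A tree $T$ is strong cop-win if and only if $T$ is a caterpillar.
   Context: All graphs are reflexive. The game of one cop and $m$ robbers: in round $0$ the cop chooses a starting vertex, then the robbers choose starting vertices (players may share vertices). In each round $i\ge1$ the cop moves to an adjacent vertex or stays, then every robber moves to an adjacent vertex or stays. Whenever the cop occupies the same vertex as some robbers, those robbers are captured and leave the game. For a cop-win graph $G$, $\operatorname{capt}(G,m)$ is the smallest $t$ such that the cop has a strategy guaranteeing all $m$ robbers are captured by round $t$ regardless of the robbers' play. $G$ is strong cop-win if $\lim_{m\to\infty}\operatorname{capt}(G,m)$ exists (is finite). A caterpillar is a tree $T$ such that $T$ minus all its leaves is a path. -}

module Defs where

open import Data.Nat using (ℕ; zero; suc; _≤_; _<_; _+_)
open import Data.Bool using (Bool; true; false; if_then_else_)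
open import Data.Fin using (Fin; toℕ; inject₁; fromℕ; _≟_)
import Data.Fin as F
open import Data.List using (List; []; _∷_; filter; map; allFin)
open import Data.Nat.ListAction using (sum)
open import Data.List.Relation.Binary.Pointwise using (Pointwise)
open import Data.Vec using (Vec; toList)
open import Data.Product using (Σ; _×_; _,_)
open import Data.Sum using (_⊎_)
open import Data.Empty using (⊥)
open import Relation.Nullary using (¬_; ¬?)
open import Relation.Binary.PropositionalEquality using (_≡_; _≢_)
open import Function.Definitions using (Injective)
open import Function.Bundles using (_⇔_)

-- The reflexivity convention of the paper
-- (every vertex has a loop) is built into the closed neighbourhood 'Close'.
record Graph : Set where
  field
    n      : ℕ
    adj    : Fin n → Fin n → Bool
    sym    : ∀ u v → adj u v ≡ adj v u
    irrefl : ∀ v → adj v v ≡ false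

module _ (G : Graph) where
  open Graph G

  V : Set
  V = Fin n

  Adj : V → V → Set
  Adj u v = adj u v ≡ true

  Close : V → V → Set
  Close u v = u ≡ v ⊎ Adj u v

  data Walk : V → V → Set where
    here : ∀ {v} → Walk v v
    step : ∀ {u w v} → Adj u w → Walk w v → Walk u v

  Connected : Set
  Connected = ∀ u v → Walk u v

  HasCycle : Set
  HasCycle = Σ ℕ λ k → Σ (Fin (suc (suc (suc k))) → V) λ f →
               Injective _≡_ _≡_ f
             × (∀ (i : Fin (suc (suc k))) → Adj (f (inject₁ i)) (f (F.suc i)))
             × Adj (f (fromℕ (suc (suc k)))) (f F.zero)

  IsTree : Set
  IsTree = (0 < n) × Connected × ¬ HasCycle

  degree : V → ℕ
  degree v = sum (map (λ w → if adj v w then 1 else 0) (allFin n))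

  Leaf : V → Set
  Leaf v = degree v ≡ 1

  -- T minus its leaves (the subgraph induced by the non-leaf vertices) is a
  -- path: its vertices can be enumerated injectively as f 0, …, f (k-1)
  -- (k = 0 allowed: the empty path) such that two of them are adjacent iff
  -- their indices are consecutive.
  RemovingLeavesGivesPath : Set
  RemovingLeavesGivesPath =
    Σ ℕ λ k → Σ (Fin k → V) λ f →
        Injective _≡_ _≡_ f
      × (∀ i → ¬ Leaf (f i))
      × (∀ v → ¬ Leaf v → Σ (Fin k) λ i → f i ≡ v)
      × (∀ i j → Adj (f i) (f j) ⇔ (toℕ j ≡ suc (toℕ i) ⊎ toℕ i ≡ suc (toℕ j)))

  IsCaterpillar : Set
  IsCaterpillar = IsTree × RemovingLeavesGivesPath

  capture : V → List V → List V
  capture c rs = filter (λ r → ¬? (r ≟ c)) rs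

  -- CopWinsWithin t c rs : the cop is at c, the remaining (uncaptured)
  -- robbers are at rs (none at c), and it is the cop's turn; the cop can
  -- guarantee that all robbers are captured within t further rounds.
  CopWinsWithin : ℕ → V → List V → Set
  CopWinsWithin zero    c rs = rs ≡ []
  CopWinsWithin (suc t) c rs =
    rs ≡ [] ⊎
    Σ V λ c' → Close c c' ×
      (∀ rs' → Pointwise Close (capture c' rs) rs' →
               CopWinsWithin t c' (capture c' rs'))

  -- capt(G,m) ≤ t : in round 0 the cop picks c₀, then the m robbers pick
  -- their positions; the cop captures all of them by round t.
  CaptWithin : ℕ → ℕ → Set
  CaptWithin m t = Σ V λ c₀ → ∀ (rs : Vec V m) →
                     CopWinsWithin t c₀ (capture c₀ (toList rs))

  CaptIs : ℕ → ℕ → Set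
  CaptIs m L = CaptWithin m L × (∀ t → t < L → ¬ CaptWithin m t)

  -- lim_{m→∞} capt(G,m) exists (is finite): a sequence of naturals converges
  -- to L iff it is eventually equal to L.
  StrongCopWin : Set
  StrongCopWin = Σ ℕ λ L → Σ ℕ λ M → ∀ m → M ≤ m → CaptIs m L

-- Against m robbers with m large, only the set of vertices that may still hold a robber matters: the cop
-- captures everybody within t rounds iff he can clear that set within t rounds, because n ^ t robbers on
-- each vertex can follow every way in which it spreads. So capt(T, m) is eventually the clearing time of
-- the set, and T is strong cop-win iff the set can be cleared at all.
--
-- A caterpillar is cleared by walking along its spine, stepping into each leaf and back. The spider, three
-- legs of length two at a centre, cannot be cleared even by a cop who jumps: the contaminated sets meeting
-- three of the four branches at the centre, or containing two whole legs, are closed under spreading, and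
-- this survives embedding the spider into T. Finally, in a tree without a spider the interior of a longest
-- path is a spine: a non-leaf vertex off it would give a spider or a longer path.

module Submission where

open import Defs
open import Data.Bool using (Bool; true; false; T; _∧_; _∨_; if_then_else_)
import Data.Bool.Properties as Bool
open import Data.Empty using (⊥; ⊥-elim)
open import Data.Fin using (Fin; zero; suc; toℕ; fromℕ<; splitAt; join; _≟_; #_)
open import Data.Fin.Properties
  using (any?; all?; 0≢1+n; toℕ-injective; toℕ-fromℕ<; toℕ<n; toℕ-inject₁; toℕ-fromℕ; pigeonhole; ¬∀⟶∃¬;
         join-splitAt)
import Data.Fin.Properties as Finₚ
open import Data.Fin.Subset using (Subset)
open import Data.Fin.Subset.Properties using (anySubset?)
open import Data.List using (List; []; _∷_; [_]; _++_; concatMap; map; allFin; replicate; length; filter)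
import Data.List as List
open import Data.List.Properties
  using (filter-++; filter-all; filter-none; length-++; length-replicate; concatMap-++; concatMap-map; ++-identityʳ;
         map-tabulate)
open import Data.List.Membership.Propositional using (_∈_; lose)
open import Data.List.Membership.Propositional.Properties using (∈-allFin; ∈-filter⁺; ∈-map⁺; ∈-concatMap⁺)
open import Data.List.Relation.Unary.All as All using (All; []; _∷_)
open import Data.List.Relation.Unary.All.Properties using (concat⁺; map⁺; all-filter; filter⁺; replicate⁺)
open import Data.List.Relation.Unary.Any using (here; there)
open import Data.List.Relation.Binary.Pointwise as Pointwise using (Pointwise; []; _∷_)
open import Data.Nat using (ℕ; zero; suc; _+_; _∸_; _≤_; _<_; _≤?_; _≤ᵇ_; z≤n; s≤s; s≤s⁻¹)
import Data.Nat.Properties as ℕ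
open import Data.Nat.ListAction using (sum)
open import Data.Product using (Σ; ∃-syntax; _×_; _,_; proj₁; proj₂; uncurry)
open import Data.Product.Properties using (≡-dec)
open import Data.Sum using (_⊎_; inj₁; inj₂; [_,_]′)
open import Data.Vec using (toList; fromList; cast; lookup; tabulate)
open import Data.Vec.Properties using (toList-cast; toList∘fromList; lookup∘tabulate)
open import Function using (_∘_; id; _⇔_; mk⇔; Equivalence)
open import Function.Definitions using (Injective)
open import Relation.Nullary using (¬_; Dec; yes; no; ¬?; contradiction)
open import Relation.Nullary.Decidable
  using (⌊_⌋; _×-dec_; _⊎-dec_; _→-dec_; toWitness; fromWitness; from-yes; T?; decidable-stable)
import Relation.Nullary.Decidable as Dec
open import Relation.Unary using (Decidable)
open import Relation.Binary.Definitions using (tri<; tri≈; tri>)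
open import Relation.Binary.PropositionalEquality
  using (_≡_; _≢_; refl; sym; trans; cong; cong₂; subst; module ≡-Reasoning)
open import Data.List.Membership.DecPropositional (≡-dec (_≟_ {7}) (_≟_ {7})) using (_∈?_)


least-witness : {P : ℕ → Set} → Decidable P → ∀ {b} → P b → Σ ℕ λ L → P L × (∀ t → t < L → ¬ P t)
least-witness P? {zero} p = zero , p , λ _ ()
least-witness P? {suc b} p with P? zero
... | yes p₀ = zero , p₀ , λ _ ()
... | no ¬p₀ with least-witness (P? ∘ suc) p
...   | L , pL , below = suc L , pL , λ where
          zero    _         → ¬p₀
          (suc t) (s≤s t<L) → below t t<L

concatMap-Pointwise : ∀ {A B : Set} {R : B → B → Set} {f g : A → List B} →
                      (∀ x → Pointwise R (f x) (g x)) → ∀ xs → Pointwise R (concatMap f xs) (concatMap g xs)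
concatMap-Pointwise fRg []       = []
concatMap-Pointwise fRg (x ∷ xs) = Pointwise.++⁺ (fRg x) (concatMap-Pointwise fRg xs)

All-across : ∀ {A : Set} {P : A → Set} {R : A → A → Set} {xs ys} →
             All P xs → Pointwise R xs ys → All (λ y → ∃[ x ] P x × R x y) ys
All-across []         []         = []
All-across (Px ∷ Pxs) (Rxy ∷ Rxsys) = (_ , Px , Rxy) ∷ All-across Pxs Rxsys

allSubsets? : ∀ {k} {P : Subset k → Set} → Decidable P → Dec (∀ A → P A)
allSubsets? P? with anySubset? (¬? ∘ P?)
... | yes (A , ¬PA) = no λ all → ¬PA (all A)
... | no  none      = yes λ A → decidable-stable (P? A) λ ¬PA → none (A , ¬PA)

count : ∀ {k} → (Fin k → Bool) → ℕ
count g = sum (List.tabulate λ i → if g i then 1 else 0)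

ExactlyOne : ∀ {k} → (Fin k → Bool) → Set
ExactlyOne g = ∃[ w ] g w ≡ true × ∀ {w′} → g w′ ≡ true → w′ ≡ w

count≡0 : ∀ {k} (g : Fin k → Bool) → count g ≡ 0 → ∀ i → g i ≡ false
count≡0 g none zero    with g zero
count≡0 g ()   zero    | true
...                    | false = refl
count≡0 g none (suc i) with g zero
count≡0 g ()   (suc i) | true
...                    | false = count≡0 (g ∘ suc) none i

none⇒count≡0 : ∀ {k} (g : Fin k → Bool) → (∀ i → g i ≡ false) → count g ≡ 0
none⇒count≡0 {zero}  g none = refl
none⇒count≡0 {suc k} g none rewrite none zero = none⇒count≡0 (g ∘ suc) (none ∘ suc)

count≡1⇒exactlyOne : ∀ {k} (g : Fin k → Bool) → count g ≡ 1 → ExactlyOne g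
count≡1⇒exactlyOne {suc k} g one with g zero in g₀
... | true  = zero , g₀ , only-zero
  where
  only-zero : ∀ {w} → g w ≡ true → w ≡ zero
  only-zero {zero}  _  = refl
  only-zero {suc i} gi = contradiction (trans (sym gi) (count≡0 (g ∘ suc) (ℕ.suc-injective one) i)) λ ()
... | false with count≡1⇒exactlyOne (g ∘ suc) one
...   | w , gw , only = suc w , gw , only-suc
  where
  only-suc : ∀ {w′} → g w′ ≡ true → w′ ≡ suc w
  only-suc {zero}  g₀′ = contradiction (trans (sym g₀′) g₀) λ ()
  only-suc {suc i} gi  = cong suc (only gi)

exactlyOne⇒count≡1 : ∀ {k} (g : Fin k → Bool) → ExactlyOne g → count g ≡ 1
exactlyOne⇒count≡1 g (zero , g₀ , only) rewrite g₀ =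
  cong suc (none⇒count≡0 (g ∘ suc) λ i → Bool.¬-not λ gi → 0≢1+n (sym (only gi)))
exactlyOne⇒count≡1 g (suc w , gw , only) with g zero in g₀
... | true  = ⊥-elim (0≢1+n (only g₀))
... | false = exactlyOne⇒count≡1 (g ∘ suc) (w , gw , Finₚ.suc-injective ∘ only)

∸-mirror : ∀ {ℓ i} → i < ℓ → ℓ ∸ suc i < ℓ
∸-mirror {i = i} (s≤s i≤m) = s≤s (ℕ.m∸n≤m _ i)

[,]-injective : ∀ {A B C : Set} {f : A → C} {g : B → C} → Injective _≡_ _≡_ f → Injective _≡_ _≡_ g →
                (∀ a b → f a ≢ g b) → Injective _≡_ _≡_ [ f , g ]′
[,]-injective f-inj g-inj apart {inj₁ a} {inj₁ a′} e = cong inj₁ (f-inj e)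
[,]-injective f-inj g-inj apart {inj₁ a} {inj₂ b}  e = contradiction e (apart a b)
[,]-injective f-inj g-inj apart {inj₂ b} {inj₁ a}  e = contradiction (sym e) (apart a b)
[,]-injective f-inj g-inj apart {inj₂ b} {inj₂ b′} e = cong inj₂ (g-inj e)

Consecutive : ∀ {k} → Fin k → Fin k → Set
Consecutive i j = toℕ j ≡ suc (toℕ i) ⊎ toℕ i ≡ suc (toℕ j)

-- The game against arbitrarily many robbers

module _ (G : Graph) where
  open Graph G using (n; adj)

  Close? : ∀ u w → Dec (Close G u w)
  Close? u w = u ≟ w ⊎-dec adj u w Bool.≟ true

  -- The vertices that may still hold a robber.
  VertexSet : Set
  VertexSet = V G → Bool

  Spreads : V G → (V G → Set) → V G → Set
  Spreads c U w = w ≢ c × ∃[ u ] U u × u ≢ c × Close G u w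

  Spreads-mono : ∀ {c U U′ w} → (∀ {v} → U v → U′ v) → Spreads c U w → Spreads c U′ w
  Spreads-mono U⊆U′ (w≢c , u , Uu , u≢c , u~w) = w≢c , u , U⊆U′ Uu , u≢c , u~w

  spread : V G → VertexSet → VertexSet
  spread c S w = ⌊ ¬? (w ≟ c) ×-dec any? (λ u → T? (S u) ×-dec ¬? (u ≟ c) ×-dec Close? u w) ⌋

  spread-sound : ∀ {c S w} → T (spread c S w) → Spreads c (T ∘ S) w
  spread-sound = toWitness

  spread-complete : ∀ {c S w} → Spreads c (T ∘ S) w → T (spread c S w)
  spread-complete = fromWitness

  Cleared : VertexSet → Set
  Cleared S = ∀ v → ¬ T (S v)

  Clears : ℕ → V G → VertexSet → Set
  Clears zero    c S = Cleared S
  Clears (suc t) c S = Cleared S ⊎ ∃[ c′ ] Close G c c′ × Clears t c′ (spread c′ S)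

  cleared? : ∀ S → Dec (Cleared S)
  cleared? S = all? (λ v → ¬? (T? (S v)))

  clears? : ∀ t c S → Dec (Clears t c S)
  clears? zero    c S = cleared? S
  clears? (suc t) c S = cleared? S ⊎-dec any? (λ c′ → Close? c c′ ×-dec clears? t c′ (spread c′ S))

  allBut : V G → VertexSet
  allBut c v = ⌊ ¬? (v ≟ c) ⌋

  ClearableWithin : ℕ → Set
  ClearableWithin t = ∃[ c ] Clears t c (allBut c)

  clearableWithin? : Decidable ClearableWithin
  clearableWithin? t = any? (λ c → clears? t c (allBut c))

  capture-all : ∀ {P : V G → Set} {c rs} → All P rs → All (λ r → P r × r ≢ c) (capture G c rs)
  capture-all {rs = rs} Prs = All.zip (filter⁺ _ Prs , all-filter _ rs)

  cleared-robbers : ∀ {S rs} → Cleared S → All (T ∘ S) rs → rs ≡ []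
  cleared-robbers cleared []       = refl
  cleared-robbers cleared (Sr ∷ _) = ⊥-elim (cleared _ Sr)

  clears⇒copWins : ∀ t {c S rs} → Clears t c S → All (T ∘ S) rs → CopWinsWithin G t c rs
  clears⇒copWins zero    cleared         Srs = cleared-robbers cleared Srs
  clears⇒copWins (suc t) (inj₁ cleared) Srs = inj₁ (cleared-robbers cleared Srs)
  clears⇒copWins (suc t) {S = S} (inj₂ (c′ , c~c′ , wins)) Srs = inj₂ (c′ , c~c′ , λ rs′ moves →
    clears⇒copWins t wins (All.map spread-after-move (capture-all (All-across (capture-all Srs) moves))))
    where
    spread-after-move : ∀ {w} → (∃[ u ] (T (S u) × u ≢ c′) × Close G u w) × w ≢ c′ → T (spread c′ S w)
    spread-after-move ((u , (Su , u≢c′) , u~w) , w≢c′) = spread-complete (w≢c′ , u , Su , u≢c′ , u~w)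

  -- n ^ j robbers on v. Each round a block splits into n smaller ones, one heading for each vertex, so the
  -- robbers realise every way in which the set of possibly occupied vertices can spread.
  block : ℕ → V G → List (V G)
  block zero    v = [ v ]
  block (suc j) v = concatMap (λ _ → block j v) (allFin n)

  robbers : ℕ → List (V G) → List (V G)
  robbers j = concatMap (block j)

  block-at : ∀ j v → All (_≡ v) (block j v)
  block-at zero    v = refl ∷ []
  block-at (suc j) v = concat⁺ (map⁺ (All.universal (λ _ → block-at j v) (allFin n)))

  ∈-block : ∀ j v → v ∈ block j v
  ∈-block zero    v = here refl
  ∈-block (suc j) v = ∈-concatMap⁺ _ (lose (∈-allFin v) (∈-block j v))

  capture-robbers : ∀ j c bs → capture G c (robbers j bs) ≡ robbers j (capture G c bs)
  capture-robbers j c []       = refl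
  capture-robbers j c (b ∷ bs) with b ≟ c
  ... | yes refl = trans (filter-++ _ (block j b) (robbers j bs))
                         (cong₂ _++_ (filter-none _ (All.map (λ b′≡b b′≢b → b′≢b b′≡b) (block-at j b)))
                                     (capture-robbers j c bs))
  ... | no b≢c   = trans (filter-++ _ (block j b) (robbers j bs))
                         (cong₂ _++_ (filter-all _ (All.map (λ { refl → b≢c }) (block-at j b)))
                                     (capture-robbers j c bs))

  stepTo : V G → V G → V G
  stepTo u w = if ⌊ Close? u w ⌋ then w else u

  stepTo-close : ∀ u w → Close G u (stepTo u w)
  stepTo-close u w with Close? u w
  ... | yes u~w = u~w
  ... | no  _   = inj₁ refl

  stepTo-≡ : ∀ {u w} → Close G u w → stepTo u w ≡ w
  stepTo-≡ {u} {w} u~w with Close? u w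
  ... | yes _   = refl
  ... | no ¬u~w = ⊥-elim (¬u~w u~w)

  move : List (V G) → List (V G)
  move = concatMap (λ u → map (stepTo u) (allFin n))

  block-close : ∀ j {u w} → Close G u w → Pointwise (Close G) (block j u) (block j w)
  block-close zero    u~w = u~w ∷ []
  block-close (suc j) u~w = concatMap-Pointwise (λ _ → block-close j u~w) (allFin n)

  robbers-move : ∀ j bs → Pointwise (Close G) (robbers (suc j) bs) (robbers j (move bs))
  robbers-move j []       = []
  robbers-move j (b ∷ bs) =
    subst (Pointwise (Close G) _) (sym (concatMap-++ (block j) (map (stepTo b) (allFin n)) (move bs)))
      (Pointwise.++⁺ block-splits (robbers-move j bs))
    where
    block-splits : Pointwise (Close G) (block (suc j) b) (robbers j (map (stepTo b) (allFin n)))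
    block-splits = subst (Pointwise (Close G) _) (sym (concatMap-map (block j) (stepTo b) (allFin n)))
                     (concatMap-Pointwise (λ w → block-close j (stepTo-close b w)) (allFin n))

  no-robbers⇒cleared : ∀ {j S} bs → (∀ {v} → T (S v) → v ∈ bs) → robbers j bs ≡ [] → Cleared S
  no-robbers⇒cleared {j} bs S⊆bs none v Sv
    with subst (v ∈_) none (∈-concatMap⁺ (block j) (lose (S⊆bs Sv) (∈-block j v)))
  ... | ()

  copWins⇒clears : ∀ {t j} → t ≤ j → ∀ {c S} bs → (∀ {v} → T (S v) → v ∈ bs) →
                   CopWinsWithin G t c (robbers j bs) → Clears t c S
  copWins⇒clears {zero}  {j} _ bs S⊆bs none        = no-robbers⇒cleared {j} bs S⊆bs none
  copWins⇒clears {suc t} {j} _ bs S⊆bs (inj₁ none) = inj₁ (no-robbers⇒cleared {j} bs S⊆bs none)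
  copWins⇒clears {suc t} {suc j} (s≤s t≤j) {S = S} bs S⊆bs (inj₂ (c′ , c~c′ , wins)) =
    inj₂ (c′ , c~c′ , copWins⇒clears t≤j bs′ spread⊆bs′ wins′)
    where
    bs′ : List (V G)
    bs′ = capture G c′ (move (capture G c′ bs))
    moves : Pointwise (Close G) (capture G c′ (robbers (suc j) bs)) (robbers j (move (capture G c′ bs)))
    moves = subst (λ rs → Pointwise (Close G) rs (robbers j (move (capture G c′ bs))))
              (sym (capture-robbers (suc j) c′ bs)) (robbers-move j (capture G c′ bs))
    wins′ : CopWinsWithin G t c′ (robbers j bs′)
    wins′ = subst (CopWinsWithin G t c′) (capture-robbers j c′ (move (capture G c′ bs))) (wins _ moves)
    spread⊆bs′ : ∀ {v} → T (spread c′ S v) → v ∈ bs′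
    spread⊆bs′ {v} Sv with spread-sound Sv
    ... | v≢c′ , u , Su , u≢c′ , u~v =
      ∈-filter⁺ _ (∈-concatMap⁺ (λ b → map (stepTo b) (allFin n))
                    (lose (∈-filter⁺ _ (S⊆bs Su) u≢c′)
                          (subst (_∈ map (stepTo u) (allFin n)) (stepTo-≡ u~v) (∈-map⁺ (stepTo u) (∈-allFin v)))))
                  v≢c′

  clearable⇒capt : ∀ {m t} → ClearableWithin t → CaptWithin G m t
  clearable⇒capt {t = t} (c₀ , clears) = c₀ , λ rs →
    clears⇒copWins t clears (All.map fromWitness (all-filter _ (toList rs)))

  -- The robbers beyond the blocks stand on the cop's initial vertex and are caught at once.
  capt⇒clearable : ∀ {m t j} → t ≤ j → length (robbers j (allFin n)) ≤ m → CaptWithin G m t → ClearableWithin t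
  capt⇒clearable {m} {t} {j} t≤j enough (c₀ , wins) =
    c₀ , copWins⇒clears t≤j (capture G c₀ (allFin n))
           (λ {v} v≢c₀ → ∈-filter⁺ _ (∈-allFin v) (toWitness v≢c₀))
           (subst (CopWinsWithin G t c₀) formation (wins (cast size (fromList rs))))
    where
    blocks : List (V G)
    blocks = robbers j (allFin n)
    rs : List (V G)
    rs = blocks ++ replicate (m ∸ length blocks) c₀
    size : length rs ≡ m
    size = trans (length-++ blocks) (trans (cong (length blocks +_) (length-replicate (m ∸ length blocks)))
                                           (ℕ.m+[n∸m]≡n enough))
    formation : capture G c₀ (toList (cast size (fromList rs))) ≡ robbers j (capture G c₀ (allFin n))
    formation = begin
      capture G c₀ (toList (cast size (fromList rs)))
        ≡⟨ cong (capture G c₀) (trans (toList-cast size (fromList rs)) (toList∘fromList rs)) ⟩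
      capture G c₀ rs
        ≡⟨ filter-++ _ blocks _ ⟩
      capture G c₀ blocks ++ capture G c₀ (replicate (m ∸ length blocks) c₀)
        ≡⟨ cong₂ _++_ (capture-robbers j c₀ (allFin n))
                      (filter-none _ (replicate⁺ (m ∸ length blocks) (λ c₀≢c₀ → c₀≢c₀ refl))) ⟩
      robbers j (capture G c₀ (allFin n)) ++ []
        ≡⟨ ++-identityʳ _ ⟩
      robbers j (capture G c₀ (allFin n)) ∎
      where open ≡-Reasoning

  strongCopWin⇔clearable : StrongCopWin G ⇔ (∃[ t ] ClearableWithin t)
  strongCopWin⇔clearable = mk⇔ to from
    where
    needed : ℕ → ℕ
    needed j = length (robbers j (allFin n))
    to : StrongCopWin G → ∃[ t ] ClearableWithin t
    to (L , M , capt) =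
      L , capt⇒clearable ℕ.≤-refl (ℕ.m≤n+m (needed L) M) (proj₁ (capt (M + needed L) (ℕ.m≤m+n M _)))
    from : ∃[ t ] ClearableWithin t → StrongCopWin G
    from (_ , clearable) with least-witness clearableWithin? clearable
    ... | L , clearableL , below = L , needed L , λ m enough →
      clearable⇒capt clearableL , λ t t<L captT → below t t<L (capt⇒clearable (ℕ.<⇒≤ t<L) enough captT)

  ClearsAll : ℕ → V G → (V G → Set) → Set
  ClearsAll t c U = ∀ S → (∀ {v} → T (S v) → U v) → Clears t c S

  clearsAll-move : ∀ {t c c′ U U′} → Close G c c′ → (∀ {w} → Spreads c′ U w → U′ w) →
                   ClearsAll t c′ U′ → ClearsAll (suc t) c U
  clearsAll-move {c′ = c′} c~c′ spread⊆U′ clears S S⊆U =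
    inj₂ (c′ , c~c′ , clears (spread c′ S) (spread⊆U′ ∘ Spreads-mono S⊆U ∘ spread-sound))

  clearsAll-none : ∀ t {c U} → (∀ v → ¬ U v) → ClearsAll t c U
  clearsAll-none zero    none S S⊆U = λ v Sv → none v (S⊆U Sv)
  clearsAll-none (suc t) none S S⊆U = inj₁ λ v Sv → none v (S⊆U Sv)

-- Graphs containing a spider

record Embedding (H G : Graph) : Set where
  field
    embed          : V H → V G
    injective      : Injective _≡_ _≡_ embed
    adj-preserving : ∀ {u v} → Adj H u v → Adj G (embed u) (embed v)

  close-preserving : ∀ {u v} → Close H u v → Close G (embed u) (embed v)
  close-preserving (inj₁ refl) = inj₁ refl
  close-preserving (inj₂ u~v)  = inj₂ (adj-preserving u~v)

  preimage : (c : V G) → V H → Σ (V H) λ q → ∀ {v} → embed v ≡ c → v ≡ q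
  preimage c fallback with any? (λ v → embed v ≟ c)
  ... | yes (q , q↦c) = q , λ v↦c → injective (trans v↦c (sym q↦c))
  ... | no  none       = fallback , λ v↦c → ⊥-elim (none (_ , v↦c))

-- spread-closed allows every q, not only neighbours of the cop: the invariant defeats even a cop who jumps.
record EvasionInvariant (H : Graph) : Set₁ where
  field
    Holds         : Subset (Graph.n H) → Set
    nonempty      : ∀ {A} → Holds A → ∃[ v ] T (lookup A v)
    spread-closed : ∀ q {A} → Holds A → Holds (tabulate (spread H q (lookup A)))
    initial       : ∀ q → Holds (tabulate (allBut H q))

module _ {H G : Graph} (H↪G : Embedding H G) (invariant : EvasionInvariant H) where
  open Embedding H↪G
  open EvasionInvariant invariant

  private
    Covers : Subset (Graph.n H) → VertexSet G → Set
    Covers A S = ∀ {v} → T (lookup A v) → T (S (embed v))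

    uncleared : ∀ {S A} → Holds A → Covers A S → ¬ Cleared G S
    uncleared holds A⊆S cleared = let v , Av = nonempty holds in cleared (embed v) (A⊆S Av)

    evades : ∀ t {c S A} → Holds A → Covers A S → ¬ Clears G t c S
    evades zero    holds A⊆S cleared        = uncleared holds A⊆S cleared
    evades (suc t) holds A⊆S (inj₁ cleared) = uncleared holds A⊆S cleared
    evades (suc t) {S = S} {A} holds A⊆S (inj₂ (c′ , _ , clears)) with preimage c′ (proj₁ (nonempty holds))
    ... | q , only-q = evades t (spread-closed q holds) spread⊆spread clears
      where
      spread⊆spread : Covers (tabulate (spread H q (lookup A))) (spread G c′ S)
      spread⊆spread {v} Av with spread-sound H (subst T (lookup∘tabulate (spread H q (lookup A)) v) Av)
      ... | v≢q , u , Au , u≢q , u~v =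
        spread-complete G ((v≢q ∘ only-q) , embed u , A⊆S Au , (u≢q ∘ only-q) , close-preserving u~v)

  -- The vertex of H is needed: the empty graph satisfies the invariant vacuously.
  embedding⇒unclearable : V H → ∀ t → ¬ ClearableWithin G t
  embedding⇒unclearable h t (c , clears) with preimage c h
  ... | q , only-q = evades t (initial q) start clears
    where
    start : Covers (tabulate (allBut H q)) (allBut G c)
    start {v} Av = fromWitness (toWitness (subst T (lookup∘tabulate (allBut H q) v) Av) ∘ only-q)

-- Three legs of length two at the centre 2: 2 - 1 - 0, 2 - 3 - 4 and 2 - 5 - 6.
spiderEdges : List (Fin 7 × Fin 7)
spiderEdges = (# 0 , # 1) ∷ (# 1 , # 2) ∷ (# 2 , # 3) ∷ (# 3 , # 4) ∷ (# 2 , # 5) ∷ (# 5 , # 6) ∷ []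

isSpiderEdge : Fin 7 → Fin 7 → Bool
isSpiderEdge u v = ⌊ (u , v) ∈? spiderEdges ⌋

spider : Graph
spider = record
  { n      = 7
  ; adj    = λ u v → isSpiderEdge u v ∨ isSpiderEdge v u
  ; sym    = λ u v → Bool.∨-comm (isSpiderEdge u v) (isSpiderEdge v u)
  ; irrefl = from-yes (all? λ v → isSpiderEdge v v ∨ isSpiderEdge v v Bool.≟ false)
  }

spiderEmbedding : ∀ {G} (s : Fin 7 → V G) → Injective _≡_ _≡_ s →
                  All (uncurry λ u v → Adj G (s u) (s v)) spiderEdges → Embedding spider G
spiderEmbedding {G} s s-injective edges = record { embed = s ; injective = s-injective ; adj-preserving = preserving }
  where
  preserving : ∀ {u v} → Adj spider u v → Adj G (s u) (s v)
  preserving {u} {v} u~v with Equivalence.to (Bool.T-∨ {isSpiderEdge u v}) (Equivalence.from Bool.T-≡ u~v)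
  ... | inj₁ uv = All.lookup edges (toWitness uv)
  ... | inj₂ vu = trans (Graph.sym G (s u) (s v)) (All.lookup edges (toWitness vu))

spiderLegs : List (Fin 7 × Fin 7)
spiderLegs = (# 1 , # 0) ∷ (# 3 , # 4) ∷ (# 5 , # 6) ∷ []

trues : List Bool → ℕ
trues = length ∘ filter T?

-- The contaminated set meets three of the four branches at the centre, or contains two whole legs.
spiderSafe : Subset 7 → Bool
spiderSafe A =  (3 ≤ᵇ trues (lookup A (# 2) ∷ map (uncurry λ i o → lookup A i ∨ lookup A o) spiderLegs))
             ∨ (2 ≤ᵇ trues (map (uncurry λ i o → lookup A i ∧ lookup A o) spiderLegs))

spiderInvariant : EvasionInvariant spider
spiderInvariant = record
  { Holds         = T ∘ spiderSafe
  ; nonempty      = λ {A} → from-yes (allSubsets? λ A → T? (spiderSafe A) →-dec any? (T? ∘ lookup A)) A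
  ; spread-closed = λ q {A} → from-yes (all? λ q → allSubsets? λ A →
                      T? (spiderSafe A) →-dec T? (spiderSafe (tabulate (spread spider q (lookup A))))) q A
  ; initial       = from-yes (all? λ q → T? (spiderSafe (tabulate (allBut spider q))))
  }

module _ (G : Graph) where
  open Graph G using (n; adj; irrefl)

  Adj-sym : ∀ {u w} → Adj G u w → Adj G w u
  Adj-sym {u} {w} u~w = trans (Graph.sym G w u) u~w

  Adj-irrefl : ∀ {u w} → Adj G u w → u ≢ w
  Adj-irrefl {u} u~u refl = contradiction (trans (sym u~u) (irrefl u)) λ ()

  leaf⇔exactlyOneNeighbour : ∀ v → Leaf G v ⇔ ExactlyOne (adj v)
  leaf⇔exactlyOneNeighbour v = mk⇔ (count≡1⇒exactlyOne (adj v) ∘ trans (sym degree≡count))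
                                   (trans degree≡count ∘ exactlyOne⇒count≡1 (adj v))
    where
    degree≡count : degree G v ≡ count (adj v)
    degree≡count = cong sum (map-tabulate id λ w → if adj v w then 1 else 0)

  Leaf? : Decidable (Leaf G)
  Leaf? v = degree G v ℕ.≟ 1

  leaf-neighbour : ∀ {v} → Leaf G v → ∃[ w ] Adj G v w × ∀ {w′} → Adj G v w′ → w′ ≡ w
  leaf-neighbour {v} = Equivalence.to (leaf⇔exactlyOneNeighbour v)

  leaf-neighbours-≡ : ∀ {v a b} → Leaf G v → Adj G v a → Adj G v b → a ≡ b
  leaf-neighbours-≡ leaf v~a v~b = let _ , _ , only = leaf-neighbour leaf in trans (only v~a) (sym (only v~b))

  nonleaf-other-neighbour : ∀ {v a} → ¬ Leaf G v → Adj G v a → ∃[ b ] Adj G v b × b ≢ a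
  nonleaf-other-neighbour {v} {a} nonleaf v~a with any? (λ b → adj v b Bool.≟ true ×-dec ¬? (b ≟ a))
  ... | yes other = other
  ... | no  none  = contradiction (Equivalence.from (leaf⇔exactlyOneNeighbour v) (a , v~a , only-a)) nonleaf
    where
    only-a : ∀ {b} → Adj G v b → b ≡ a
    only-a {b} v~b with b ≟ a
    ... | yes b≡a = b≡a
    ... | no  b≢a = contradiction (b , v~b , b≢a) none

  adjacent-leaves-closed : ∀ {v w} → Leaf G v → Leaf G w → Adj G v w →
                           ∀ {x u} → Walk G x u → x ≡ v ⊎ x ≡ w → u ≡ v ⊎ u ≡ w
  adjacent-leaves-closed lv lw v~w here             x∈vw        = x∈vw
  adjacent-leaves-closed lv lw v~w (step x~y walk) (inj₁ refl) =
    adjacent-leaves-closed lv lw v~w walk (inj₂ (leaf-neighbours-≡ lv x~y v~w))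
  adjacent-leaves-closed lv lw v~w (step x~y walk) (inj₂ refl) =
    adjacent-leaves-closed lv lw v~w walk (inj₁ (leaf-neighbours-≡ lw x~y (Adj-sym v~w)))

-- Clearing a caterpillar

module _ (G : Graph) where
  open Graph G using (n; adj)

  -- If every vertex is a leaf, the tree is a single edge v₀ - w and the cop just steps across it.
  allLeaves⇒clearable : 0 < n → Connected G → (∀ v → Leaf G v) → ClearableWithin G 1
  allLeaves⇒clearable 0<n connected leaf with leaf-neighbour G (leaf (fromℕ< 0<n))
  ... | w , v₀~w , _ = v₀ , clearsAll-move G (inj₂ v₀~w) nothing-spreads finished (allBut G v₀) only-w
    where
    v₀ : V G
    v₀ = fromℕ< 0<n
    only-w : ∀ {u} → T (allBut G v₀ u) → u ≡ w
    only-w {u} u≢v₀ = [ (λ u≡v₀ → contradiction u≡v₀ (toWitness u≢v₀)) , (λ u≡w → u≡w) ]′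
                        (adjacent-leaves-closed G (leaf v₀) (leaf w) v₀~w (connected v₀ u) (inj₁ refl))
    nothing-spreads : ∀ {x} → Spreads G w (_≡ w) x → ⊥
    nothing-spreads (_ , u , u≡w , u≢w , _) = u≢w u≡w
    finished : ClearsAll G 0 w (λ _ → ⊥)
    finished = clearsAll-none G 0 {c = w} {U = λ _ → ⊥} λ _ ()

  module SpineSweep (connected : Connected G) {k} (spine : Fin (suc k) → V G)
                    (spine-nonleaf : ∀ i → ¬ Leaf G (spine i))
                    (nonleaf-spine : ∀ v → ¬ Leaf G v → ∃[ i ] spine i ≡ v)
                    (spine-adj : ∀ i j → Adj G (spine i) (spine j) ⇔ Consecutive i j) where

    LeafAt : Fin (suc k) → V G → Set
    LeafAt a v = Adj G (spine a) v × Leaf G v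

    LeafAt? : ∀ a → Decidable (LeafAt a)
    LeafAt? a v = adj (spine a) v Bool.≟ true ×-dec Leaf? G v

    leavesAt : Fin (suc k) → List (V G)
    leavesAt a = filter (LeafAt? a) (allFin n)

    Beyond : Fin (suc k) → V G → Set
    Beyond i v = ∃[ b ] toℕ i < toℕ b × (v ≡ spine b ⊎ LeafAt b v)

    spine-or-leaf : ∀ v → (∃[ i ] spine i ≡ v) ⊎ Leaf G v
    spine-or-leaf v with Leaf? G v
    ... | yes leaf    = inj₂ leaf
    ... | no  nonleaf = inj₁ (nonleaf-spine v nonleaf)

    leaf-hangs-off-spine : ∀ {v} → Leaf G v → ∃[ a ] LeafAt a v
    leaf-hangs-off-spine {v} leaf with leaf-neighbour G leaf
    ... | w , v~w , _ with spine-or-leaf w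
    ...   | inj₁ (a , refl) = a , Adj-sym G v~w , leaf
    ...   | inj₂ leaf-w with adjacent-leaves-closed G leaf leaf-w v~w (connected v (spine zero)) (inj₁ refl)
    ...     | inj₁ s₀≡v = contradiction (subst (Leaf G) (sym s₀≡v) leaf) (spine-nonleaf zero)
    ...     | inj₂ s₀≡w = contradiction (subst (Leaf G) (sym s₀≡w) leaf-w) (spine-nonleaf zero)

    spine-neighbour : ∀ {a w} → Adj G (spine a) w → (∃[ b ] spine b ≡ w × Consecutive a b) ⊎ LeafAt a w
    spine-neighbour {a} {w} a~w with spine-or-leaf w
    ... | inj₁ (b , refl) = inj₁ (b , refl , Equivalence.to (spine-adj a b) a~w)
    ... | inj₂ leaf       = inj₂ (a~w , leaf)

    leafAt-close : ∀ {a u w} → LeafAt a u → Close G u w → w ≡ u ⊎ w ≡ spine a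
    leafAt-close _                 (inj₁ refl) = inj₁ refl
    leafAt-close (a~u , leaf) (inj₂ u~w)  = inj₂ (leaf-neighbours-≡ G leaf u~w (Adj-sym G a~u))

    beyond-close : ∀ {i u w} → Beyond i u → Close G u w →
                   Beyond i w ⊎ (w ≡ spine i × ∃[ b ] toℕ b ≡ suc (toℕ i) × u ≡ spine b)
    beyond-close (b , i<b , inj₁ refl)  (inj₁ refl) = inj₁ (b , i<b , inj₁ refl)
    beyond-close (b , i<b , inj₁ refl)  (inj₂ b~w) with spine-neighbour b~w
    ... | inj₂ leafAt                   = inj₁ (b , i<b , inj₂ leafAt)
    ... | inj₁ (b′ , refl , inj₁ b′≡b+1) = inj₁ (b′ , subst (_ <_) (sym b′≡b+1) (ℕ.m<n⇒m<1+n i<b) , inj₁ refl)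
    ... | inj₁ (b′ , refl , inj₂ b≡b′+1) with ℕ.m≤n⇒m<n∨m≡n (s≤s⁻¹ (subst (_ <_) b≡b′+1 i<b))
    ...   | inj₁ i<b′ = inj₁ (b′ , i<b′ , inj₁ refl)
    ...   | inj₂ i≡b′ =
      inj₂ (cong spine (toℕ-injective (sym i≡b′)) , b , trans b≡b′+1 (cong suc (sym i≡b′)) , refl)
    beyond-close (b , i<b , inj₂ leafAt) u~w with leafAt-close leafAt u~w
    ... | inj₁ refl = inj₁ (b , i<b , inj₂ leafAt)
    ... | inj₂ w≡b  = inj₁ (b , i<b , inj₁ w≡b)

    visit-leaves : ∀ {t} i ℓs → All (LeafAt i) ℓs → ClearsAll G t (spine i) (Beyond i) →
                   ∃[ t′ ] ClearsAll G t′ (spine i) (λ v → Beyond i v ⊎ v ∈ ℓs)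
    visit-leaves {t} i [] _ clears = t , λ S S⊆ → clears S λ Sv → [ (λ beyond → beyond) , (λ ()) ]′ (S⊆ Sv)
    visit-leaves i (ℓ ∷ ℓs) ((i~ℓ , ℓ-leaf) ∷ leaves) clears with visit-leaves i ℓs leaves clears
    ... | t , clears′ = suc (suc t) ,
          clearsAll-move G (inj₂ i~ℓ) at-ℓ (clearsAll-move G (inj₂ (Adj-sym G i~ℓ)) back-at-i clears′)
      where
      at-ℓ : ∀ {w} → Spreads G ℓ (λ v → Beyond i v ⊎ v ∈ ℓ ∷ ℓs) w → (Beyond i w ⊎ w ∈ ℓs) ⊎ w ≡ spine i
      at-ℓ (_ , u , inj₁ beyond , _ , u~w) with beyond-close beyond u~w
      ... | inj₁ beyond′    = inj₁ (inj₁ beyond′)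
      ... | inj₂ (w≡i , _) = inj₂ w≡i
      at-ℓ (_ , u , inj₂ (here u≡ℓ) , u≢ℓ , _) = contradiction u≡ℓ u≢ℓ
      at-ℓ (_ , u , inj₂ (there u∈ℓs) , _ , u~w) with leafAt-close (All.lookup leaves u∈ℓs) u~w
      ... | inj₁ refl = inj₁ (inj₂ u∈ℓs)
      ... | inj₂ w≡i  = inj₂ w≡i
      back-at-i : ∀ {w} → Spreads G (spine i) (λ v → (Beyond i v ⊎ v ∈ ℓs) ⊎ v ≡ spine i) w →
                  Beyond i w ⊎ w ∈ ℓs
      back-at-i (w≢i , u , inj₁ (inj₁ beyond) , _ , u~w) with beyond-close beyond u~w
      ... | inj₁ beyond′    = inj₁ beyond′
      ... | inj₂ (w≡i , _) = contradiction w≡i w≢i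
      back-at-i (w≢i , u , inj₁ (inj₂ u∈ℓs) , _ , u~w) with leafAt-close (All.lookup leaves u∈ℓs) u~w
      ... | inj₁ refl = inj₂ u∈ℓs
      ... | inj₂ w≡i  = contradiction w≡i w≢i
      back-at-i (_ , u , inj₂ u≡i , u≢i , _) = contradiction u≡i u≢i

    advance : ∀ {i i′} → toℕ i′ ≡ suc (toℕ i) →
              ∀ {w} → Spreads G (spine i′) (Beyond i) w → Beyond i′ w ⊎ w ∈ leavesAt i′
    advance {i′ = i′} i′≡i+1 (w≢i′ , u , beyond , u≢i′ , u~w) with beyond-close beyond u~w
    ... | inj₂ (_ , b , b≡i+1 , u≡b) =
      contradiction (trans u≡b (cong spine (toℕ-injective (trans b≡i+1 (sym i′≡i+1))))) u≢i′
    ... | inj₁ (b , i<b , w-at-b) with ℕ.m≤n⇒m<n∨m≡n (subst (_≤ toℕ b) (sym i′≡i+1) i<b)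
    ...   | inj₁ i′<b = inj₁ (b , i′<b , w-at-b)
    ...   | inj₂ i′≡b with toℕ-injective i′≡b | w-at-b
    ...     | refl | inj₁ w≡i′  = contradiction w≡i′ w≢i′
    ...     | refl | inj₂ leafAt = inj₂ (∈-filter⁺ (LeafAt? i′) (∈-allFin _) leafAt)

    next-index : ∀ (i : Fin (suc k)) d → toℕ i + suc d ≡ k →
                 Σ (Fin (suc k)) λ i′ → toℕ i′ ≡ suc (toℕ i) × toℕ i′ + d ≡ k
    next-index i d i+d+1≡k = fromℕ< (s≤s i+1≤k) , i′≡i+1 , trans (cong (_+ d) i′≡i+1) i+1+d≡k
      where
      i+1+d≡k : suc (toℕ i) + d ≡ k
      i+1+d≡k = trans (sym (ℕ.+-suc (toℕ i) d)) i+d+1≡k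
      i+1≤k : suc (toℕ i) ≤ k
      i+1≤k = subst (suc (toℕ i) ≤_) i+1+d≡k (ℕ.m≤m+n (suc (toℕ i)) d)
      i′≡i+1 : toℕ (fromℕ< {n = suc k} (s≤s i+1≤k)) ≡ suc (toℕ i)
      i′≡i+1 = toℕ-fromℕ< (s≤s i+1≤k)

    visit-all-leaves : ∀ {t} i → ClearsAll G t (spine i) (Beyond i) →
                       ∃[ t′ ] ClearsAll G t′ (spine i) (λ v → Beyond i v ⊎ v ∈ leavesAt i)
    visit-all-leaves i = visit-leaves i (leavesAt i) (all-filter (LeafAt? i) (allFin n))

    sweep : ∀ d i → toℕ i + d ≡ k → ∃[ t ] ClearsAll G t (spine i) (Beyond i)
    sweep zero i i≡k = 0 , clearsAll-none G 0 {c = spine i} {U = Beyond i} λ where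
      _ (b , i<b , _) → ℕ.<-irrefl refl (ℕ.<-≤-trans (subst (_< toℕ b) (trans (sym (ℕ.+-identityʳ _)) i≡k) i<b)
                                                 (s≤s⁻¹ (toℕ<n b)))
    sweep (suc d) i i+d+1≡k with next-index i d i+d+1≡k
    ... | i′ , i′≡i+1 , i′+d≡k with visit-all-leaves i′ (proj₂ (sweep d i′ i′+d≡k))
    ...   | t , clears =
      suc t , clearsAll-move G (inj₂ (Equivalence.from (spine-adj i i′) (inj₁ i′≡i+1))) (advance i′≡i+1) clears

    clearable : ∃[ t ] ClearableWithin G t
    clearable with visit-all-leaves zero (proj₂ (sweep k zero refl))
    ... | t , clears = t , spine zero , clears (allBut G (spine zero)) start
      where
      start : ∀ {v} → T (allBut G (spine zero) v) → Beyond zero v ⊎ v ∈ leavesAt zero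
      start {v} v≢s₀ with spine-or-leaf v
      ... | inj₁ (zero  , refl) = contradiction refl (toWitness v≢s₀)
      ... | inj₁ (suc b , refl) = inj₁ (suc b , s≤s z≤n , inj₁ refl)
      ... | inj₂ leaf with leaf-hangs-off-spine leaf
      ...   | zero  , leafAt = inj₂ (∈-filter⁺ (LeafAt? zero) (∈-allFin v) leafAt)
      ...   | suc a , leafAt = inj₁ (suc a , s≤s z≤n , inj₂ leafAt)

-- Longest paths in spider-free trees

module _ (G : Graph) where

  -- Only the indices below ℓ matter; at is total on ℕ to keep the index arithmetic free of Fin.
  record Path (ℓ : ℕ) : Set where
    field
      at        : ℕ → V G
      injective : ∀ {i j} → i < ℓ → j < ℓ → at i ≡ at j → i ≡ j
      linked    : ∀ {i} → suc i < ℓ → Adj G (at i) (at (suc i))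

  open Path public

  OnPath : ∀ {ℓ} → Path ℓ → V G → Set
  OnPath {ℓ} P v = ∃[ i ] i < ℓ × at P i ≡ v

  onPath? : ∀ {ℓ} (P : Path ℓ) → Decidable (OnPath P)
  onPath? {ℓ} P v = Dec.map′ (λ (i , e) → toℕ i , toℕ<n i , e)
                             (λ (i , i<ℓ , e) → fromℕ< i<ℓ , trans (cong (at P) (toℕ-fromℕ< i<ℓ)) e)
                             (any? λ i → at P (toℕ i) ≟ v)

  Longer : ℕ → Set
  Longer ℓ = ∃[ ℓ′ ] ℓ < ℓ′ × Path ℓ′

  segment : ∀ {ℓ} i ℓ′ → ℓ′ + i ≤ ℓ → Path ℓ → Path ℓ′
  segment i ℓ′ fits P = record
    { at        = λ m → at P (m + i)
    ; injective = λ m<ℓ′ m′<ℓ′ e → ℕ.+-cancelʳ-≡ i _ _ (injective P (bound m<ℓ′) (bound m′<ℓ′) e)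
    ; linked    = λ m+1<ℓ′ → linked P (bound m+1<ℓ′)
    }
    where
    bound : ∀ {m} → m < ℓ′ → m + i < _
    bound m<ℓ′ = ℕ.≤-trans (ℕ.+-monoˡ-< i m<ℓ′) fits

  onPath-segment : ∀ {ℓ} {i ℓ′} {fits : ℓ′ + i ≤ ℓ} (P : Path ℓ) {v} →
                   OnPath (segment i ℓ′ fits P) v → OnPath P v
  onPath-segment {i = i} {fits = fits} P (m , m<ℓ′ , e) = m + i , ℕ.≤-trans (ℕ.+-monoˡ-< i m<ℓ′) fits , e

  cons : ∀ {ℓ x} (P : Path ℓ) → ¬ OnPath P x → Adj G x (at P 0) → Path (suc ℓ)
  cons {x = x} P x-off x~P₀ = record { at = at′ ; injective = injective′ ; linked = linked′ }
    where
    at′ : ℕ → V G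
    at′ zero    = x
    at′ (suc m) = at P m
    injective′ : ∀ {i j} → i < _ → j < _ → at′ i ≡ at′ j → i ≡ j
    injective′ {zero}  {zero}  _       _       _ = refl
    injective′ {zero}  {suc j} _       j+1<ℓ e = contradiction (j , s≤s⁻¹ j+1<ℓ , sym e) x-off
    injective′ {suc i} {zero}  i+1<ℓ _       e = contradiction (i , s≤s⁻¹ i+1<ℓ , e) x-off
    injective′ {suc i} {suc j} i+1<ℓ j+1<ℓ e = cong suc (injective P (s≤s⁻¹ i+1<ℓ) (s≤s⁻¹ j+1<ℓ) e)
    linked′ : ∀ {i} → suc i < suc _ → Adj G (at′ i) (at′ (suc i))
    linked′ {zero}  _       = x~P₀
    linked′ {suc i} i+2<ℓ = linked P (s≤s⁻¹ i+2<ℓ)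

  onPath-cons : ∀ {ℓ x v} (P : Path ℓ) (x-off : ¬ OnPath P x) (x~P₀ : Adj G x (at P 0)) →
                OnPath (cons P x-off x~P₀) v → v ≡ x ⊎ OnPath P v
  onPath-cons P _ _ (zero  , _ , e)    = inj₁ (sym e)
  onPath-cons P _ _ (suc i , i+1<ℓ , e) = inj₂ (i , s≤s⁻¹ i+1<ℓ , e)

  reverse : ∀ {ℓ} → Path ℓ → Path ℓ
  reverse {ℓ} P = record
    { at        = λ i → at P (ℓ ∸ suc i)
    ; injective = λ i<ℓ j<ℓ e →
                    ℕ.suc-injective (ℕ.∸-cancelˡ-≡ i<ℓ j<ℓ (injective P (∸-mirror i<ℓ) (∸-mirror j<ℓ) e))
    ; linked    = linked′
    }
    where
    linked′ : ∀ {i} → suc i < ℓ → Adj G (at P (ℓ ∸ suc i)) (at P (ℓ ∸ suc (suc i)))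
    linked′ {i} i+2≤ℓ =
      subst (λ m → Adj G (at P m) (at P (ℓ ∸ suc (suc i)))) (sym shift)
        (Adj-sym G (linked P (subst (_< ℓ) shift (∸-mirror (ℕ.<⇒≤ i+2≤ℓ)))))
      where
      shift : ℓ ∸ suc i ≡ suc (ℓ ∸ suc (suc i))
      shift = ℕ.+-∸-assoc 1 i+2≤ℓ

  reverse-at : ∀ {ℓ j} (P : Path ℓ) → j < ℓ → at (reverse P) (ℓ ∸ suc j) ≡ at P j
  reverse-at P (s≤s j≤m) = cong (at P) (ℕ.m∸[m∸n]≡n j≤m)

  onPath-reverse : ∀ {ℓ} (P : Path ℓ) {v} → OnPath (reverse P) v → OnPath P v
  onPath-reverse {ℓ} P (i , i<ℓ , e) = ℓ ∸ suc i , ∸-mirror i<ℓ , e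

  path-length≤n : ∀ {ℓ} → Path ℓ → ℓ ≤ Graph.n G
  path-length≤n {ℓ} P with ℓ ≤? Graph.n G
  ... | yes ℓ≤n = ℓ≤n
  ... | no  ℓ≰n with pigeonhole (ℕ.≰⇒> ℓ≰n) (λ i → at P (toℕ i))
  ...   | i , j , i<j , e = contradiction (injective P (toℕ<n i) (toℕ<n j) e) (ℕ.<⇒≢ i<j)

  closed-path⇒cycle : ∀ k (P : Path (3 + k)) → Adj G (at P (2 + k)) (at P 0) → HasCycle G
  closed-path⇒cycle k P closing =
    k , at P ∘ toℕ , (λ e → toℕ-injective (injective P (toℕ<n _) (toℕ<n _) e)) ,
    (λ i → subst (λ m → Adj G (at P m) (at P (suc (toℕ i)))) (sym (toℕ-inject₁ i)) (linked P (s≤s (toℕ<n i)))) ,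
    subst (λ m → Adj G (at P m) (at P 0)) (sym (toℕ-fromℕ (2 + k))) closing

  module _ (acyclic : ¬ HasCycle G) where

    no-chord : ∀ {ℓ i j} (P : Path ℓ) → suc i < j → j < ℓ → ¬ Adj G (at P i) (at P j)
    no-chord {ℓ} {i} P i+1<j j<ℓ i~j with ℕ.m≤n⇒∃[o]m+o≡n i+1<j
    ... | d , refl = acyclic (closed-path⇒cycle d (segment i (3 + d) fits P)
                               (subst (λ m → Adj G (at P m) (at P i)) (sym (cong (2 +_) (ℕ.+-comm d i)))
                                      (Adj-sym G i~j)))
      where
      fits : 3 + d + i ≤ ℓ
      fits = subst (_< ℓ) (sym (cong (2 +_) (ℕ.+-comm d i))) j<ℓ

    one-attachment : ∀ {ℓ x j l} (P : Path ℓ) → ¬ OnPath P x → j < l → l < ℓ →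
                     Adj G x (at P j) → ¬ Adj G x (at P l)
    one-attachment {ℓ} {x} {j} P x-off j<l l<ℓ x~j x~l with ℕ.m≤n⇒∃[o]m+o≡n j<l
    ... | d , refl =
      acyclic (closed-path⇒cycle d (cons (segment j (2 + d) fits P) (x-off ∘ onPath-segment {fits = fits} P) x~j)
                                   (subst (λ m → Adj G (at P m) x) (cong (1 +_) (ℕ.+-comm j d)) (Adj-sym G x~l)))
      where
      fits : 2 + d + j ≤ ℓ
      fits = subst (_< ℓ) (cong (1 +_) (ℕ.+-comm j d)) l<ℓ

    attachment-unique : ∀ {ℓ x j l} (P : Path ℓ) → ¬ OnPath P x → j < ℓ → l < ℓ →
                        Adj G x (at P j) → Adj G x (at P l) → j ≡ l
    attachment-unique {j = j} {l} P x-off j<ℓ l<ℓ x~j x~l with ℕ.<-cmp j l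
    ... | tri< j<l _ _ = contradiction x~l (one-attachment P x-off j<l l<ℓ x~j)
    ... | tri≈ _ j≡l _ = j≡l
    ... | tri> _ _ l<j = contradiction x~j (one-attachment P x-off l<j j<ℓ x~l)

    first-leaf-or-longer : ∀ {k} (P : Path (2 + k)) → Leaf G (at P 0) ⊎ Longer (2 + k)
    first-leaf-or-longer P with Leaf? G (at P 0)
    ... | yes leaf    = inj₁ leaf
    ... | no  nonleaf with nonleaf-other-neighbour G nonleaf (linked P (s≤s (s≤s z≤n)))
    ...   | u , P₀~u , u≢P₁ with onPath? P u
    ...     | no  u-off                     = inj₂ (_ , ℕ.≤-refl , cons P u-off (Adj-sym G P₀~u))
    ...     | yes (zero , _ , P₀≡u)          = contradiction P₀≡u (Adj-irrefl G P₀~u)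
    ...     | yes (suc zero , _ , P₁≡u)      = contradiction (sym P₁≡u) u≢P₁
    ...     | yes (suc (suc m) , m+2<ℓ , Pm≡u) =
      contradiction (subst (Adj G (at P 0)) (sym Pm≡u) P₀~u) (no-chord P (s≤s (s≤s z≤n)) m+2<ℓ)

    record Hanging {ℓ} (P : Path ℓ) : Set where
      constructor hanging
      field
        x y   : V G
        j     : ℕ
        x-off : ¬ OnPath P x
        y-off : ¬ OnPath P y
        x~y   : Adj G x y
        j<ℓ   : j < ℓ
        x~j   : Adj G x (at P j)

    -- Follow a walk from u to the path: x is its last vertex off the path and y the one before, or, when
    -- x = u is not a leaf, a second neighbour of u, which is off the path since x has only one neighbour on it.
    find-hanging : ∀ {ℓ u w} (P : Path ℓ) → ¬ OnPath P u → (¬ Leaf G u ⊎ ∃[ y ] ¬ OnPath P y × Adj G u y) →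
                   Walk G u w → OnPath P w → Hanging P
    find-hanging P u-off _ here w-on = contradiction w-on u-off
    find-hanging {u = u} P u-off extra (step {w = v} u~v walk) w-on with onPath? P v
    ... | no v-off = find-hanging P v-off (inj₂ (u , u-off , Adj-sym G u~v)) walk w-on
    ... | yes (j , j<ℓ , refl) with extra
    ...   | inj₂ (y , y-off , u~y) = hanging u y j u-off y-off u~y j<ℓ u~v
    ...   | inj₁ nonleaf with nonleaf-other-neighbour G nonleaf u~v
    ...     | y , u~y , y≢Pj = hanging u y j u-off y-off u~y j<ℓ u~v
      where
      y-off : ¬ OnPath P y
      y-off (l , l<ℓ , refl) = y≢Pj (cong (at P) (sym (attachment-unique P u-off j<ℓ l<ℓ u~v u~y)))

    extend : ∀ {ℓ} (P : Path ℓ) (h : Hanging P) → Hanging.j h ≤ 1 → Longer ℓ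
    extend {ℓ} P (hanging x y j x-off y-off x~y j<ℓ x~j) j≤1 = _ , longer , cons P″ y-off″ (Adj-sym G x~y)
      where
      fits : ℓ ∸ j + j ≤ ℓ
      fits = ℕ.≤-reflexive (ℕ.m∸n+n≡m (ℕ.<⇒≤ j<ℓ))
      P′ : Path (ℓ ∸ j)
      P′ = segment j (ℓ ∸ j) fits P
      x-off′ : ¬ OnPath P′ x
      x-off′ = x-off ∘ onPath-segment {fits = fits} P
      P″ : Path (suc (ℓ ∸ j))
      P″ = cons P′ x-off′ x~j
      y-off″ : ¬ OnPath P″ y
      y-off″ on with onPath-cons P′ x-off′ x~j on
      ... | inj₁ y≡x = Adj-irrefl G x~y (sym y≡x)
      ... | inj₂ on′ = y-off (onPath-segment {fits = fits} P on′)
      longer : ℓ < 2 + (ℓ ∸ j)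
      longer = s≤s (ℕ.≤-trans (ℕ.m≤n+m∸n ℓ j) (ℕ.+-monoˡ-≤ (ℓ ∸ j) j≤1))

    -- The path vertices a, …, a + 4 become the spider's 0 - 1 - 2 - 3 - 4, and x, y its vertices 5, 6.
    spider-on-path : ∀ {ℓ} (P : Path ℓ) a (h : Hanging P) → Hanging.j h ≡ 2 + a → 5 + a ≤ ℓ → Embedding spider G
    spider-on-path {ℓ} P a (hanging x y _ x-off y-off x~y _ x~j) refl 5+a≤ℓ =
      spiderEmbedding s s-injective
        (linked P (in-range (# 1)) ∷ linked P (in-range (# 2)) ∷ linked P (in-range (# 3)) ∷ linked P (in-range (# 4)) ∷
         Adj-sym G x~j ∷ x~y ∷ [])
      where
      in-range : ∀ (r : Fin 5) → toℕ r + a < ℓ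
      in-range r = ℕ.≤-trans (s≤s (ℕ.+-monoˡ-≤ a (s≤s⁻¹ (toℕ<n r)))) 5+a≤ℓ
      on-path : Fin 5 → V G
      on-path r = at P (toℕ r + a)
      on-path-injective : Injective _≡_ _≡_ on-path
      on-path-injective {r} {r′} e = toℕ-injective (ℕ.+-cancelʳ-≡ a _ _ (injective P (in-range r) (in-range r′) e))
      leg : Fin 2 → V G
      leg zero    = x
      leg (suc _) = y
      leg-injective : Injective _≡_ _≡_ leg
      leg-injective {zero}       {zero}       _ = refl
      leg-injective {zero}       {suc zero} e = contradiction e (Adj-irrefl G x~y)
      leg-injective {suc zero} {zero}       e = contradiction (sym e) (Adj-irrefl G x~y)
      leg-injective {suc zero} {suc zero} _ = refl
      apart : ∀ r l → on-path r ≢ leg l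
      apart r zero    e = x-off (toℕ r + a , in-range r , e)
      apart r (suc _) e = y-off (toℕ r + a , in-range r , e)
      s : Fin 7 → V G
      s = [ on-path , leg ]′ ∘ splitAt 5
      s-injective : Injective _≡_ _≡_ s
      s-injective {i} {j} e = begin
        i                      ≡⟨ join-splitAt 5 2 i ⟨
        join 5 2 (splitAt 5 i) ≡⟨ cong (join 5 2) split≡ ⟩
        join 5 2 (splitAt 5 j) ≡⟨ join-splitAt 5 2 j ⟩
        j                      ∎
        where
        open ≡-Reasoning
        split≡ : splitAt 5 i ≡ splitAt 5 j
        split≡ = [,]-injective on-path-injective leg-injective apart {splitAt 5 i} {splitAt 5 j} e

    reflect : ∀ {ℓ} {P : Path ℓ} → Hanging P → Hanging (reverse P)
    reflect {ℓ} {P} (hanging x y j x-off y-off x~y j<ℓ x~j) =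
      hanging x y (ℓ ∸ suc j) (x-off ∘ onPath-reverse P) (y-off ∘ onPath-reverse P) x~y
              (∸-mirror j<ℓ)
              (subst (Adj G x) (sym (reverse-at P j<ℓ)) x~j)

    -- A vertex hanging off the middle of a path makes a spider; near an end it makes the path longer.
    branch : ∀ {ℓ} (P : Path ℓ) → Hanging P → Embedding spider G ⊎ Longer ℓ
    branch P h@(hanging _ _ zero _ _ _ _ _)          = inj₂ (extend P h z≤n)
    branch P h@(hanging _ _ (suc zero) _ _ _ _ _)    = inj₂ (extend P h (s≤s z≤n))
    branch {ℓ} P h@(hanging _ _ (suc (suc a)) _ _ _ j<ℓ _) with 5 + a ≤? ℓ
    ... | yes 5+a≤ℓ = inj₁ (spider-on-path P a h refl 5+a≤ℓ)
    ... | no  5+a≰ℓ = inj₂ (extend (reverse P) (reflect h)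
                              (ℕ.≤-trans (ℕ.∸-monoˡ-≤ (3 + a) (s≤s⁻¹ (ℕ.≰⇒> 5+a≰ℓ)))
                                         (ℕ.≤-reflexive (ℕ.m+n∸n≡m 1 (3 + a)))))

    spine-from-path : ∀ {k} (P : Path (2 + k)) → Leaf G (at P 0) → Leaf G (at P (suc k)) →
                      (∀ v → Leaf G v ⊎ OnPath P v) → RemovingLeavesGivesPath G
    spine-from-path {k} P leaf₀ leaf₁ covered = k , f , f-injective , f-nonleaf , f-covers , f-adj
      where
      f : Fin k → V G
      f i = at P (suc (toℕ i))
      inner : ∀ (i : Fin k) → suc (toℕ i) < 2 + k
      inner i = s≤s (ℕ.m<n⇒m<1+n (toℕ<n i))
      f-injective : Injective _≡_ _≡_ f
      f-injective {i} {j} e = toℕ-injective (ℕ.suc-injective (injective P (inner i) (inner j) e))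
      f-nonleaf : ∀ i → ¬ Leaf G (f i)
      f-nonleaf i leaf = ℕ.<⇒≢ (ℕ.<-trans (ℕ.n<1+n _) (ℕ.n<1+n _))
        (injective P (ℕ.<-trans (ℕ.n<1+n _) (inner i)) (s≤s (s≤s (toℕ<n i)))
          (leaf-neighbours-≡ G leaf (Adj-sym G (linked P (inner i))) (linked P (s≤s (s≤s (toℕ<n i))))))
      f-covers : ∀ v → ¬ Leaf G v → Σ (Fin k) λ i → f i ≡ v
      f-covers v nonleaf with covered v
      ... | inj₁ leaf = contradiction leaf nonleaf
      ... | inj₂ (zero , _ , P₀≡v)        = contradiction (subst (Leaf G) P₀≡v leaf₀) nonleaf
      ... | inj₂ (suc i , i+1<ℓ , Pi+1≡v) with ℕ.m≤n⇒m<n∨m≡n (s≤s⁻¹ (s≤s⁻¹ i+1<ℓ))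
      ...   | inj₁ i<k = fromℕ< i<k , trans (cong (at P ∘ suc) (toℕ-fromℕ< i<k)) Pi+1≡v
      ...   | inj₂ refl = contradiction (subst (Leaf G) Pi+1≡v leaf₁) nonleaf
      f-adj : ∀ i j → Adj G (f i) (f j) ⇔ Consecutive i j
      f-adj i j = mk⇔ to from
        where
        to : Adj G (f i) (f j) → Consecutive i j
        to i~j with ℕ.<-cmp (toℕ i) (toℕ j)
        ... | tri≈ _ i≡j _ = contradiction (cong (at P ∘ suc) i≡j) (Adj-irrefl G i~j)
        ... | tri< i<j _ _ with ℕ.m≤n⇒m<n∨m≡n i<j
        ...   | inj₂ i+1≡j  = inj₁ (sym i+1≡j)
        ...   | inj₁ i+1<j  = contradiction i~j (no-chord P (s≤s i+1<j) (inner j))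
        to i~j | tri> _ _ j<i with ℕ.m≤n⇒m<n∨m≡n j<i
        ...   | inj₂ j+1≡i  = inj₂ (sym j+1≡i)
        ...   | inj₁ j+1<i  = contradiction (Adj-sym G i~j) (no-chord P (s≤s j+1<i) (inner i))
        from : Consecutive i j → Adj G (f i) (f j)
        from (inj₁ j≡i+1) = subst (λ m → Adj G (f i) (at P (suc m))) (sym j≡i+1)
                                  (linked P (subst (λ m → suc m < 2 + k) j≡i+1 (inner j)))
        from (inj₂ i≡j+1) = Adj-sym G (subst (λ m → Adj G (f j) (at P (suc m))) (sym i≡j+1)
                                  (linked P (subst (λ m → suc m < 2 + k) i≡j+1 (inner i))))

    module _ (connected : Connected G) (no-spider : ¬ Embedding spider G) where

      improve : ∀ {k} (P : Path (2 + k)) → RemovingLeavesGivesPath G ⊎ Longer (2 + k)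
      improve P with first-leaf-or-longer P | first-leaf-or-longer (reverse P)
      ... | inj₂ longer | _           = inj₂ longer
      ... | inj₁ _      | inj₂ longer = inj₂ longer
      ... | inj₁ leaf₀  | inj₁ leaf₁ with all? (λ v → Leaf? G v ⊎-dec onPath? P v)
      ...   | yes covered = inj₁ (spine-from-path P leaf₀ leaf₁ covered)
      ...   | no  uncovered with ¬∀⟶∃¬ _ _ (λ v → Leaf? G v ⊎-dec onPath? P v) uncovered
      ...     | v , v-inner-off with branch P (find-hanging P (v-inner-off ∘ inj₂) (inj₁ (v-inner-off ∘ inj₁))
                                                           (connected v (at P 0)) (0 , s≤s z≤n , refl))
      ...       | inj₁ embedding = contradiction embedding no-spider
      ...       | inj₂ longer    = inj₂ longer

      -- The fuel bounds how often the path can still grow: its length never exceeds the number of vertices.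
      longest-path : ∀ fuel {k} → Path (2 + k) → Graph.n G < 2 + k + fuel → RemovingLeavesGivesPath G
      longest-path zero P n<ℓ =
        contradiction (path-length≤n P) (ℕ.<⇒≱ (subst (Graph.n G <_) (ℕ.+-identityʳ _) n<ℓ))
      longest-path (suc fuel) {k} P n<ℓ+fuel+1 with improve P
      ... | inj₁ spine = spine
      ... | inj₂ (suc zero , s≤s () , _)
      ... | inj₂ (suc (suc k′) , ℓ<ℓ′ , P′) =
        longest-path fuel P′ (ℕ.<-≤-trans n<ℓ+fuel+1 (ℕ.≤-trans (ℕ.≤-reflexive (ℕ.+-suc (2 + k) fuel))
                                                               (ℕ.+-monoˡ-≤ fuel ℓ<ℓ′)))

  edge-path : ∀ {u w} → Adj G u w → Path 2
  edge-path {u} {w} u~w = record { at = at′ ; injective = injective′ ; linked = linked′ }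
    where
    at′ : ℕ → V G
    at′ zero    = u
    at′ (suc _) = w
    injective′ : ∀ {i j} → i < 2 → j < 2 → at′ i ≡ at′ j → i ≡ j
    injective′ {zero}     {zero}     _ _ _ = refl
    injective′ {zero}     {suc zero} _ _ e = contradiction e (Adj-irrefl G u~w)
    injective′ {suc zero} {zero}     _ _ e = contradiction (sym e) (Adj-irrefl G u~w)
    injective′ {suc zero} {suc zero} _ _ _ = refl
    injective′ {suc (suc _)} (s≤s (s≤s ())) _ _
    injective′ {_} {suc (suc _)} _ (s≤s (s≤s ())) _
    linked′ : ∀ {i} → suc i < 2 → Adj G (at′ i) (at′ (suc i))
    linked′ {zero} _ = u~w
    linked′ {suc _} (s≤s (s≤s ()))

  isolated-spine : ∀ {v₀} → Connected G → (∀ w → ¬ Adj G v₀ w) → RemovingLeavesGivesPath G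
  isolated-spine {v₀} connected isolated = 1 , (λ _ → v₀) , single-injective , nonleaf , covers , no-edge
    where
    single-injective : Injective _≡_ _≡_ (λ (_ : Fin 1) → v₀)
    single-injective {zero} {zero} _ = refl
    nonleaf : Fin 1 → ¬ Leaf G v₀
    nonleaf _ leaf = isolated _ (proj₁ (proj₂ (leaf-neighbour G leaf)))
    only-v₀ : ∀ {v} → Walk G v₀ v → v₀ ≡ v
    only-v₀ here          = refl
    only-v₀ (step v₀~w _) = contradiction v₀~w (isolated _)
    covers : ∀ v → ¬ Leaf G v → Σ (Fin 1) λ i → v₀ ≡ v
    covers v _ = zero , only-v₀ (connected v₀ v)
    no-edge : ∀ (i j : Fin 1) → Adj G v₀ v₀ ⇔ Consecutive i j
    no-edge zero zero = mk⇔ (λ v₀~v₀ → contradiction v₀~v₀ (isolated v₀)) λ { (inj₁ ()) ; (inj₂ ()) }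

  spiderFree⇒spine : IsTree G → ¬ Embedding spider G → RemovingLeavesGivesPath G
  spiderFree⇒spine (0<n , connected , acyclic) no-spider with any? (λ w → Graph.adj G v₀ w Bool.≟ true)
    where
    v₀ : V G
    v₀ = fromℕ< 0<n
  ... | yes (w , v₀~w) = longest-path acyclic connected no-spider (Graph.n G) (edge-path v₀~w) (s≤s (ℕ.m≤n+m _ 1))
  ... | no  isolated   = isolated-spine connected λ w v₀~w → isolated (w , v₀~w)

spider⇒unclearable : ∀ {G} → Embedding spider G → ∀ t → ¬ ClearableWithin G t
spider⇒unclearable spider↪G = embedding⇒unclearable spider↪G spiderInvariant (# 0)

caterpillar⇒clearable : ∀ G → IsCaterpillar G → ∃[ t ] ClearableWithin G t
caterpillar⇒clearable G ((0<n , connected , _) , zero , _ , _ , _ , covers , _) =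
  1 , allLeaves⇒clearable G 0<n connected leaf
  where
  no-spine : Fin 0 → ⊥
  no-spine ()
  leaf : ∀ v → Leaf G v
  leaf v = decidable-stable (Leaf? G v) λ nonleaf → no-spine (proj₁ (covers v nonleaf))
caterpillar⇒clearable G ((_ , connected , _) , suc k , spine , _ , spine-nonleaf , covers , spine-adj) =
  SpineSweep.clearable G connected spine spine-nonleaf covers spine-adj

proposition4p6 : (T : Graph) → IsTree T → (StrongCopWin T ⇔ IsCaterpillar T)
proposition4p6 T tree = mk⇔
  (λ strong → let t , clearable = Equivalence.to (strongCopWin⇔clearable T) strong in
              tree , spiderFree⇒spine T tree λ spider↪T → spider⇒unclearable spider↪T t clearable)
  (Equivalence.from (strongCopWin⇔clearable T) ∘ caterpillar⇒clearable T)
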